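{- Let $G$ be a finite connected bicolored digraph that contains no monochromatic directed cycles. Then $G$ has a unique bikernel if and only if every critical vertex of $G$ is a supercritical vertex.
   Context: A bicolored digraph has each arc colored $1$ or $2$. A vertex $v$ is a 1-sink if no arc of color $1$ leaves $v$, and a 2-source if no arc of color $2$ enters $v$. A vertex is critical if it is a 1-sink or a 2-source, and supercritical if it is both a 1-sink and a 2-source. A non-empty set $B\subseteq V(G)$ is a bikernel (by monochromatic paths) if: (i) for all distinct $u,v\in B$ there is no monochromatic directed $uv$-path; (ii) for every $v\in V(G)\setminus B$ there is a directed path of color $1$ from $v$ to a vertex of $B$; (iii) for every $v\in V(G)\setminus B$ there is a directed path of color $2$ from a vertex of $B$ to $v$. -}

module Defs where

open import Data.Nat using (ℕ)
open import Data.Fin using (Fin)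
open import Data.Fin.Subset using (Subset; _∈_; _∉_; Nonempty)
open import Data.Maybe using (Maybe; just)
open import Data.Product using (Σ; ∃; _×_)
open import Data.Sum using (_⊎_)
open import Data.Empty using (⊥)
open import Relation.Nullary using (¬_)
open import Relation.Binary.PropositionalEquality using (_≡_; _≢_)
open import Relation.Binary.Construct.Closure.ReflexiveTransitive using (Star)
open import Relation.Binary.Construct.Closure.Transitive using (TransClosure)

data Colour : Set where
  c1 c2 : Colour

-- A finite bicoloured digraph on vertex set Fin n: arc u v = just c means
-- there is an arc u → v of colour c; nothing means no arc u → v.
record BiDigraph (n : ℕ) : Set where
  field
    arc : Fin n → Fin n → Maybe Colour

module _ {n : ℕ} (G : BiDigraph n) where
  open BiDigraph G

  Arc : Colour → Fin n → Fin n → Set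
  Arc c u v = arc u v ≡ just c

  Adj : Fin n → Fin n → Set
  Adj u v = (∃ λ c → Arc c u v) ⊎ (∃ λ c → Arc c v u)

  Path : Colour → Fin n → Fin n → Set
  Path c = Star (Arc c)

  Connected : Set
  Connected = ∀ u v → Star Adj u v

  NoMonoCycle : Set
  NoMonoCycle = ∀ c v → ¬ TransClosure (Arc c) v v

  OneSink : Fin n → Set
  OneSink v = ∀ w → ¬ Arc c1 v w

  TwoSource : Fin n → Set
  TwoSource v = ∀ u → ¬ Arc c2 u v

  Critical : Fin n → Set
  Critical v = OneSink v ⊎ TwoSource v

  Supercritical : Fin n → Set
  Supercritical v = OneSink v × TwoSource v

  record Bikernel (B : Subset n) : Set where
    field
      nonempty    : Nonempty B
      independent : ∀ u v → u ∈ B → v ∈ B → u ≢ v → ∀ c → ¬ Path c u v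
      absorbing   : ∀ v → v ∉ B → ∃ λ b → b ∈ B × Path c1 v b
      dominating  : ∀ v → v ∉ B → ∃ λ b → b ∈ B × Path c2 b v

  UniqueBikernel : Set
  UniqueBikernel = ∃ λ B → Bikernel B × (∀ B′ → Bikernel B′ → B′ ≡ B)

-- Without monochromatic cycles, finiteness lets every vertex run along colour 1 into a
-- 1-sink and back along colour 2 to a 2-source. A critical vertex can be neither absorbed
-- nor dominated by another vertex, so it lies in every bikernel; and then independence
-- forbids any colour-1 arc out of, or colour-2 arc into, a bikernel vertex. So the only
-- candidate bikernel is the set of 1-sinks, and it is one exactly when every critical
-- vertex is supercritical, the 2-sources being needed to dominate.

module Submission where

open import Defs
open import Data.Nat using (ℕ; _≥_; zero; suc; _<_; _≤_; s≤s)
open import Data.Nat.Properties using (n<1+n; ≤-pred; <⇒≤; m<1+n⇒m<n∨m≡n)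
open import Data.Fin using (Fin; toℕ; zero)
open import Data.Fin.Properties using (pigeonhole; toℕ<n; any?; all?)
open import Data.Fin.Subset using (Subset; _∈_)
open import Data.Fin.Subset.Properties using (⊆-antisym; _∈?_)
open import Data.Vec using (tabulate)
open import Data.Vec.Properties using (lookup∘tabulate; []=⇒lookup; lookup⇒[]=)
open import Data.Bool.Properties using (T-≡)
open import Data.Maybe using (just)
open import Data.Maybe.Properties using (≡-dec)
open import Data.Product using (_×_; ∃; _,_; proj₁; proj₂)
open import Data.Sum using (_⊎_; inj₁; inj₂)
open import Data.Empty using (⊥-elim)
open import Function using (_∘_; flip; id)
open import Function.Bundles using (Equivalence)
open import Level using (Level)
open import Relation.Nullary using (¬_; yes; no; ¬?)
open import Relation.Nullary.Decidable using (⌊_⌋; toWitness; fromWitness)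
open import Relation.Unary as U using (Pred)
open import Relation.Binary using (Rel; Decidable; DecidableEquality)
open import Relation.Binary.PropositionalEquality using (_≡_; _≢_; refl; trans; sym; subst)
open import Relation.Binary.Construct.Closure.ReflexiveTransitive using (Star; ε; _◅_; _◅◅_; reverse)
open import Relation.Binary.Construct.Closure.Transitive using (TransClosure; [_]; _∷_; _∷ʳ_)

private
  variable
    ℓ : Level
    n : ℕ

reverse⁺ : {A : Set} {R : Rel A ℓ} {x y : A} → TransClosure (flip R) x y → TransClosure R y x
reverse⁺ [ r ]     = [ r ]
reverse⁺ (r ∷ rs) = reverse⁺ rs ∷ʳ r

module FiniteAcyclic {R : Rel (Fin n) ℓ} (R? : Decidable R)
                     (acyclic : ∀ v → ¬ TransClosure R v v) where

  Terminal : Pred (Fin n) ℓ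
  Terminal v = ∀ w → ¬ R v w

  ReachesTerminal : Pred (Fin n) ℓ
  ReachesTerminal v = ∃ λ t → Terminal t × Star R v t

  record Walk (k : ℕ) (v : Fin n) : Set ℓ where
    field
      vertex : ℕ → Fin n
      start  : vertex 0 ≡ v
      step   : ∀ {i} → i < k → R (vertex i) (vertex (suc i))

  walk-or-terminal : ∀ k v → Walk k v ⊎ ReachesTerminal v
  walk-or-terminal zero v = inj₁ record { vertex = λ _ → v ; start = refl ; step = λ () }
  walk-or-terminal (suc k) v with any? (R? v)
  ... | no  v-terminal = inj₂ (v , (λ w r → v-terminal (w , r)) , ε)
  ... | yes (w , r) with walk-or-terminal k w
  ...   | inj₂ (t , t-terminal , w⇝t) = inj₂ (t , t-terminal , r ◅ w⇝t)
  ...   | inj₁ walk = inj₁ record { vertex = vertex′ ; start = refl ; step = step′ }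
    where
    open Walk walk
    vertex′ : ℕ → Fin n
    vertex′ zero    = v
    vertex′ (suc i) = vertex i
    step′ : ∀ {i} → i < suc k → R (vertex′ i) (vertex′ (suc i))
    step′ {zero}  _       = subst (R v) (sym start) r
    step′ {suc i} (s≤s i<k) = step i<k

  walk-segment : ∀ {k v} (walk : Walk k v) → let open Walk walk in
                 ∀ {i j} → i < j → j ≤ k → TransClosure R (vertex i) (vertex j)
  walk-segment walk {j = suc j} i<1+j 1+j≤k with m<1+n⇒m<n∨m≡n i<1+j
  ... | inj₁ i<j  = walk-segment walk i<j (<⇒≤ 1+j≤k) ∷ʳ Walk.step walk 1+j≤k
  ... | inj₂ refl = [ Walk.step walk 1+j≤k ]

  -- A walk with n steps visits n + 1 vertices, so by pigeonhole it closes a cycle.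
  reachesTerminal : ∀ v → ReachesTerminal v
  reachesTerminal v with walk-or-terminal n v
  ... | inj₂ reaches = reaches
  ... | inj₁ walk with pigeonhole (n<1+n n) (Walk.vertex walk ∘ toℕ)
  ...   | i , j , i<j , same = ⊥-elim (acyclic (vertex (toℕ j)) cycle)
    where
    open Walk walk
    cycle : TransClosure R (vertex (toℕ j)) (vertex (toℕ j))
    cycle = subst (λ x → TransClosure R x (vertex (toℕ j))) same
                  (walk-segment walk i<j (≤-pred (toℕ<n j)))

module _ {P : Pred (Fin n) ℓ} (P? : U.Decidable P) where

  toSubset : Subset n
  toSubset = tabulate (⌊_⌋ ∘ P?)

  ∈-toSubset⁺ : ∀ {v} → P v → v ∈ toSubset
  ∈-toSubset⁺ {v} p = lookup⇒[]= v toSubset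
    (trans (lookup∘tabulate (⌊_⌋ ∘ P?) v) (Equivalence.to T-≡ (fromWitness p)))

  ∈-toSubset⁻ : ∀ {v} → v ∈ toSubset → P v
  ∈-toSubset⁻ {v} v∈ = toWitness (Equivalence.from T-≡
    (trans (sym (lookup∘tabulate (⌊_⌋ ∘ P?) v)) ([]=⇒lookup v∈)))

_≟-Colour_ : DecidableEquality Colour
c1 ≟-Colour c1 = yes refl
c1 ≟-Colour c2 = no λ ()
c2 ≟-Colour c1 = no λ ()
c2 ≟-Colour c2 = yes refl

module _ (G : BiDigraph n) where
  open BiDigraph G

  arc? : ∀ c → Decidable (Arc G c)
  arc? c u v = ≡-dec _≟-Colour_ (arc u v) (just c)

  oneSink? : U.Decidable (OneSink G)
  oneSink? v = all? λ w → ¬? (arc? c1 v w)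

  oneSinks : Subset n
  oneSinks = toSubset oneSink?

  path-from-oneSink : ∀ {v w} → OneSink G v → Path G c1 v w → v ≡ w
  path-from-oneSink v-sink ε       = refl
  path-from-oneSink v-sink (a ◅ _) = ⊥-elim (v-sink _ a)

  path-to-twoSource : ∀ {u v} → TwoSource G v → Path G c2 u v → u ≡ v
  path-to-twoSource v-source ε = refl
  path-to-twoSource v-source (a ◅ p) with refl ← path-to-twoSource v-source p =
    ⊥-elim (v-source _ a)

  critical∈bikernel : ∀ {B v} → Bikernel G B → Critical G v → v ∈ B
  critical∈bikernel {B} {v} B-bikernel v-critical with v ∈? B
  ... | yes v∈B = v∈B
  ... | no  v∉B with v-critical
  ...   | inj₁ v-sink with b , b∈B , v⇝b ← Bikernel.absorbing B-bikernel v v∉B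
          with refl ← path-from-oneSink v-sink v⇝b = ⊥-elim (v∉B b∈B)
  ...   | inj₂ v-source with b , b∈B , b⇝v ← Bikernel.dominating B-bikernel v v∉B
          with refl ← path-to-twoSource v-source b⇝v = ⊥-elim (v∉B b∈B)

  module _ (noMonoCycle : NoMonoCycle G) where

    reachesOneSink : ∀ v → ∃ λ s → OneSink G s × Path G c1 v s
    reachesOneSink = FiniteAcyclic.reachesTerminal (arc? c1) (noMonoCycle c1)

    reachedFromTwoSource : ∀ v → ∃ λ s → TwoSource G s × Path G c2 s v
    reachedFromTwoSource v
      with s , s-source , v⇜s ← FiniteAcyclic.reachesTerminal (flip (arc? c2))
                                   (λ v → noMonoCycle c2 v ∘ reverse⁺) v
      = s , s-source , reverse id v⇜s

    ∈bikernel⇒oneSink : ∀ {B v} → Bikernel G B → v ∈ B → OneSink G v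
    ∈bikernel⇒oneSink B-bikernel v∈B w a
      with s , s-sink , w⇝s ← reachesOneSink w
      = Bikernel.independent B-bikernel _ s v∈B
          (critical∈bikernel B-bikernel (inj₁ s-sink)) (λ { refl → s-sink w a }) c1 (a ◅ w⇝s)

    ∈bikernel⇒twoSource : ∀ {B v} → Bikernel G B → v ∈ B → TwoSource G v
    ∈bikernel⇒twoSource B-bikernel v∈B u a
      with s , s-source , s⇝u ← reachedFromTwoSource u
      = Bikernel.independent B-bikernel s _
          (critical∈bikernel B-bikernel (inj₂ s-source)) v∈B (λ { refl → s-source u a }) c2
          (s⇝u ◅◅ a ◅ ε)

    bikernel⇒critical-supercritical : ∀ {B} → Bikernel G B → ∀ v → Critical G v → Supercritical G v
    bikernel⇒critical-supercritical B-bikernel v v-critical =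
      ∈bikernel⇒oneSink B-bikernel v∈B , ∈bikernel⇒twoSource B-bikernel v∈B
      where v∈B = critical∈bikernel B-bikernel v-critical

    bikernel≡oneSinks : ∀ B → Bikernel G B → B ≡ oneSinks
    bikernel≡oneSinks B B-bikernel = ⊆-antisym
      (∈-toSubset⁺ oneSink? ∘ ∈bikernel⇒oneSink B-bikernel)
      (critical∈bikernel B-bikernel ∘ inj₁ ∘ ∈-toSubset⁻ oneSink?)

    oneSinks-bikernel : (∀ v → Critical G v → Supercritical G v) → Fin n → Bikernel G oneSinks
    oneSinks-bikernel supercritical v₀ = record
      { nonempty    = let s , s-sink , _ = reachesOneSink v₀ in s , ∈-toSubset⁺ oneSink? s-sink
      ; independent = independent
      ; absorbing   = λ v _ → let s , s-sink , v⇝s = reachesOneSink v in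
                                s , ∈-toSubset⁺ oneSink? s-sink , v⇝s
      ; dominating  = λ v _ → let s , s-source , s⇝v = reachedFromTwoSource v in
          s , ∈-toSubset⁺ oneSink? (proj₁ (supercritical s (inj₂ s-source))) , s⇝v
      }
      where
      independent : ∀ u v → u ∈ oneSinks → v ∈ oneSinks → u ≢ v → ∀ c → ¬ Path G c u v
      independent u v u∈ v∈ u≢v c1 = u≢v ∘ path-from-oneSink (∈-toSubset⁻ oneSink? u∈)
      independent u v u∈ v∈ u≢v c2 =
        u≢v ∘ path-to-twoSource (proj₂ (supercritical v (inj₁ (∈-toSubset⁻ oneSink? v∈))))

mainTheorem9 : (n : ℕ) → n ≥ 1 → (G : BiDigraph n) → Connected G → NoMonoCycle G →
    (UniqueBikernel G → (∀ v → Critical G v → Supercritical G v)) ×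
    ((∀ v → Critical G v → Supercritical G v) → UniqueBikernel G)
mainTheorem9 (suc _) _ G _ noMonoCycle =
  (λ (_ , B-bikernel , _) → bikernel⇒critical-supercritical G noMonoCycle B-bikernel) ,
  λ supercritical → oneSinks G ,
                    oneSinks-bikernel G noMonoCycle supercritical zero ,
                    bikernel≡oneSinks G noMonoCycle
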